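{- Let $d\ge3$, $h\ge1$. The sandpile group $G(d,h)$ has a cyclic subgroup of order $(d-1)^h$.
   Context: Let $\mathcal{T}(d,h)$ be the ball of radius $h$ about a root vertex $0$ in the infinite $d$-regular tree (root has $d$ children, vertices at depth $1,\dots,h-1$ have $d-1$ children, depth-$h$ vertices are leaves). Let $V$ be its vertex set, $p(i)$ the parent of $i\neq 0$, $C_i$ the children of $i$, $\{\mathbf{x}_i\}$ the standard basis of $\mathbb{Z}^V$, and $\delta_i = d\mathbf{x}_i - \mathbf{x}_{p(i)} - \sum_{j\in C_i}\mathbf{x}_j$ (omit $\mathbf{x}_{p(i)}$ for $i=0$; empty sum for leaves). The sandpile group is $G(d,h)=\mathbb{Z}^V/\sum_{i\in V}\mathbb{Z}\delta_i$. -}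

module Defs where

open import Data.Nat as ℕ using (ℕ; zero; suc; _≤_; _<_; _∸_; _≡ᵇ_)
open import Data.Nat.Properties using (≤-trans; n≤1+n; ≤-refl)
open import Data.Fin using (Fin; toℕ)
open import Data.Vec using (Vec; []; _∷_; toList)
open import Data.List using (List; []; _∷_; _++_; map; concatMap; allFin; foldr)
open import Data.Bool using (Bool; true; false; _∧_; not; if_then_else_)
open import Data.Integer using (ℤ; +_; _+_; _*_; _-_; 0ℤ; 1ℤ)
open import Data.Product using (Σ; ∃; _×_)
open import Relation.Binary.PropositionalEquality using (_≡_)
open import Relation.Nullary using (¬_)

-- Vertices of T(d,h): the root, or a vertex at depth (suc k), k < h, given by
-- the index a : Fin d of its depth-1 ancestor and the list of child indices
-- (each in Fin (d-1)) along the path below it, MOST RECENT STEP FIRST.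
data Vtx (d h : ℕ) : Set where
  root : Vtx d h
  node : (k : ℕ) → suc k ≤ h → Fin d → Vec (Fin (d ∸ 1)) k → Vtx d h

module _ {d h : ℕ} where

  isRoot : Vtx d h → Bool
  isRoot root = true
  isRoot (node _ _ _ _) = false

  -- parent p(i) (p(root) = root is a dummy value, never used)
  parent : Vtx d h → Vtx d h
  parent root = root
  parent (node zero _ a []) = root
  parent (node (suc k) lt a (b ∷ p)) = node k (≤-trans (n≤1+n (suc k)) lt) a p

  private
    eqList : List ℕ → List ℕ → Bool
    eqList [] [] = true
    eqList (x ∷ xs) (y ∷ ys) = (x ≡ᵇ y) ∧ eqList xs ys
    eqList _ _ = false

  _==_ : Vtx d h → Vtx d h → Bool
  root == root = true
  root == node _ _ _ _ = false
  node _ _ _ _ == root = false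
  node k _ a p == node k' _ a' p' =
    (k ≡ᵇ k') ∧ ((toℕ a ≡ᵇ toℕ a') ∧ eqList (map toℕ (toList p)) (map toℕ (toList p')))

allVecs : (n k : ℕ) → List (Vec (Fin n) k)
allVecs n zero = [] ∷ []
allVecs n (suc k) = concatMap (λ b → map (b ∷_) (allVecs n k)) (allFin n)

level : (d h m : ℕ) → suc m ≤ h → List (Vtx d h)
level d h m le = concatMap (λ a → map (node m le a) (allVecs (d ∸ 1) m)) (allFin d)

nodesUpTo : (d h m : ℕ) → m ≤ h → List (Vtx d h)
nodesUpTo d h zero _ = []
nodesUpTo d h (suc m) le = nodesUpTo d h m (≤-trans (n≤1+n m) le) ++ level d h m le

allV : (d h : ℕ) → List (Vtx d h)
allV d h = root ∷ nodesUpTo d h h ≤-refl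

ΣV : (d h : ℕ) → (Vtx d h → ℤ) → ℤ
ΣV d h f = foldr (λ i s → f i + s) 0ℤ (allV d h)

[_] : Bool → ℤ
[ b ] = if b then 1ℤ else 0ℤ

isChild : {d h : ℕ} → Vtx d h → Vtx d h → Bool
isChild j i = not (isRoot j) ∧ (parent j == i)

-- δ_i = d x_i - x_{p(i)} - Σ_{j ∈ C_i} x_j  (x_{p(i)} omitted for i = root),
-- as an element of ℤ^V (a function V → ℤ)
δ : (d h : ℕ) → Vtx d h → Vtx d h → ℤ
δ d h i v = ((+ d) * [ v == i ] - [ not (isRoot i) ∧ (v == parent i) ])
            - ΣV d h (λ j → [ isChild j i ] * [ v == j ])

InLattice : (d h : ℕ) → (Vtx d h → ℤ) → Set
InLattice d h x = ∃ λ (c : Vtx d h → ℤ) → ∀ v → x v ≡ ΣV d h (λ i → c i * δ d h i v)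

_•_ : {d h : ℕ} → ℕ → (Vtx d h → ℤ) → (Vtx d h → ℤ)
(n • x) v = + n * x v

-- the class of x in G(d,h) = ℤ^V / Σ ℤ δ_i has (additive) order exactly n
HasOrder : (d h : ℕ) → (Vtx d h → ℤ) → ℕ → Set
HasOrder d h x n = (0 < n) × InLattice d h (n • x)
                   × (∀ m → 0 < m → m < n → ¬ InLattice d h (m • x))

HasCyclicSubgroupOfOrder : (d h n : ℕ) → Set
HasCyclicSubgroupOfOrder d h n = ∃ λ (x : Vtx d h → ℤ) → HasOrder d h x n

-- Write q = d − 1, L a = Σᵢ aᵢ δᵢ, and let P(v) = 1 + q + ⋯ + q^(h − depth v).  At a vertex
-- v ≠ 0 the identity d·P(v) = q·P(child) + P(parent) (with P(child) read as 0 at leaves) says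
-- (L P)(v) = 0, while at the root (L P)(0) = d·(P(0) − P(child)) = d·qʰ.  So L P = qʰ·g for
-- g = d·x₀, and the class of g has order dividing qʰ.  Conversely, if m·g = L a then, L being
-- symmetric, m·d·P(0) = ⟨P, m·g⟩ = ⟨P, L a⟩ = ⟨L P, a⟩ = qʰ·d·a₀; since P(0) ≡ 1 (mod q) is
-- coprime to q, this forces qʰ ∣ m.

module Submission where

open import Defs
open import Data.Bool using (Bool; true; false; _∧_; not)
open import Data.Empty using (⊥-elim)
open import Data.Fin using (Fin; toℕ; zero; suc)
open import Data.Integer using (ℤ; +_; _+_; _*_; _-_; -_; 0ℤ; 1ℤ; ∣_∣)
import Data.Integer.Properties as ℤ
open import Data.Integer.Tactic.RingSolver using (solve-∀)
open import Data.List using (List; []; _∷_; _++_; map; concatMap; allFin; foldr)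
open import Data.List.Properties using (map-tabulate)
open import Data.Nat as ℕ using (ℕ; zero; suc; _≤_; _<_; _∸_; _≡ᵇ_; _^_; s≤s; z≤n; _≤?_; NonZero; >-nonZero)
open import Data.Nat.Coprimality as Coprime using (Coprime; coprime-divisor; 1-coprimeTo)
open import Data.Nat.Divisibility
  using (_∣_; divides; ∣-trans; m∣m*n; 1∣_; ∣1⇒≡1; ∣m+n∣m⇒∣n; *-cancelˡ-∣; *-monoʳ-∣; ∣⇒≤)
open import Data.Nat.Properties
  using (_≟_; ≤-refl; n≤1+n; ≤-trans; ≤-irrelevant; <⇒≢; <⇒≤; ≤∧≢⇒<; ≤-pred; ≰⇒>; <⇒≱; m≤n⇒m∸n≡0; m^n>0; *-comm; +-comm)
open import Data.Nat.Tactic.RingSolver using () renaming (solve-∀ to ℕ-solve-∀)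
open import Data.Product using (_,_)
open import Data.Vec using (Vec; []; _∷_)
open import Function using (_∘_; id)
open import Relation.Binary.PropositionalEquality hiding ([_])
open import Relation.Nullary using (yes; no; ¬_)

open ≡-Reasoning

∑ : {A : Set} → List A → (A → ℤ) → ℤ
∑ xs f = foldr (λ x s → f x + s) 0ℤ xs

module _ {A : Set} where

  ∑-cong : (xs : List A) {f g : A → ℤ} → (∀ x → f x ≡ g x) → ∑ xs f ≡ ∑ xs g
  ∑-cong []       f≡g = refl
  ∑-cong (x ∷ xs) f≡g = cong₂ _+_ (f≡g x) (∑-cong xs f≡g)

  ∑-zero : (xs : List A) {f : A → ℤ} → (∀ x → f x ≡ 0ℤ) → ∑ xs f ≡ 0ℤ
  ∑-zero []       f≡0 = refl
  ∑-zero (x ∷ xs) f≡0 = cong₂ _+_ (f≡0 x) (∑-zero xs f≡0)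

  ∑-++ : (xs ys : List A) (f : A → ℤ) → ∑ (xs ++ ys) f ≡ ∑ xs f + ∑ ys f
  ∑-++ []       ys f = sym (ℤ.+-identityˡ _)
  ∑-++ (x ∷ xs) ys f = trans (cong (_+_ (f x)) (∑-++ xs ys f)) (sym (ℤ.+-assoc (f x) _ _))

  ∑-map : {B : Set} (g : B → A) (xs : List B) (f : A → ℤ) → ∑ (map g xs) f ≡ ∑ xs (f ∘ g)
  ∑-map g []       f = refl
  ∑-map g (x ∷ xs) f = cong (_+_ (f (g x))) (∑-map g xs f)

  ∑-concatMap : {B : Set} (g : B → List A) (xs : List B) (f : A → ℤ) →
                ∑ (concatMap g xs) f ≡ ∑ xs (λ x → ∑ (g x) f)
  ∑-concatMap g []       f = refl
  ∑-concatMap g (x ∷ xs) f =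
    trans (∑-++ (g x) (concatMap g xs) f) (cong (_+_ (∑ (g x) f)) (∑-concatMap g xs f))

  ∑-+ : (xs : List A) (f g : A → ℤ) → ∑ xs (λ x → f x + g x) ≡ ∑ xs f + ∑ xs g
  ∑-+ []       f g = refl
  ∑-+ (x ∷ xs) f g = trans (cong (_+_ (f x + g x)) (∑-+ xs f g)) (interchange (f x) (g x) _ _)
    where
    interchange : ∀ a b c e → (a + b) + (c + e) ≡ (a + c) + (b + e)
    interchange = solve-∀

  ∑-neg : (xs : List A) (f : A → ℤ) → ∑ xs (λ x → - f x) ≡ - ∑ xs f
  ∑-neg []       f = refl
  ∑-neg (x ∷ xs) f = trans (cong (_+_ (- f x)) (∑-neg xs f)) (sym (ℤ.neg-distrib-+ (f x) _))

  ∑-*ˡ : (xs : List A) (k : ℤ) (f : A → ℤ) → ∑ xs (λ x → k * f x) ≡ k * ∑ xs f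
  ∑-*ˡ []       k f = sym (ℤ.*-zeroʳ k)
  ∑-*ˡ (x ∷ xs) k f = trans (cong (_+_ (k * f x)) (∑-*ˡ xs k f)) (sym (ℤ.*-distribˡ-+ k (f x) _))

  ∑-*ʳ : (xs : List A) (k : ℤ) (f : A → ℤ) → ∑ xs (λ x → f x * k) ≡ ∑ xs f * k
  ∑-*ʳ xs k f = trans (∑-cong xs (λ x → ℤ.*-comm (f x) k)) (trans (∑-*ˡ xs k f) (ℤ.*-comm k _))

∑-swap : {A B : Set} (xs : List A) (ys : List B) (F : A → B → ℤ) →
         ∑ xs (λ x → ∑ ys (F x)) ≡ ∑ ys (λ y → ∑ xs (λ x → F x y))
∑-swap []       ys F = sym (∑-zero ys (λ _ → refl))
∑-swap (x ∷ xs) ys F =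
  trans (cong (_+_ (∑ ys (F x))) (∑-swap xs ys F)) (sym (∑-+ ys (F x) (λ y → ∑ xs (λ x′ → F x′ y))))

∑-allFin-suc : ∀ n (f : Fin (suc n) → ℤ) → ∑ (allFin (suc n)) f ≡ f zero + ∑ (allFin n) (f ∘ suc)
∑-allFin-suc n f =
  cong (_+_ (f zero)) (trans (cong (λ xs → ∑ xs f) (sym (map-tabulate id suc))) (∑-map suc (allFin n) f))

∑-allFin-const : ∀ n k → ∑ (allFin n) (λ _ → k) ≡ + n * k
∑-allFin-const zero    k = sym (ℤ.*-zeroˡ k)
∑-allFin-const (suc n) k = begin
  ∑ (allFin (suc n)) (λ _ → k) ≡⟨ ∑-allFin-suc n (λ _ → k) ⟩
  k + ∑ (allFin n) (λ _ → k)   ≡⟨ cong (_+_ k) (∑-allFin-const n k) ⟩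
  k + + n * k                  ≡⟨ sym (ℤ.suc-* (+ n) k) ⟩
  + suc n * k                  ∎

∑-adjoint : {A : Set} (xs : List A) (K : A → A → ℤ) → (∀ i j → K i j ≡ K j i) → (a b : A → ℤ) →
            ∑ xs (λ j → b j * ∑ xs (λ i → a i * K i j)) ≡ ∑ xs (λ i → a i * ∑ xs (λ j → b j * K j i))
∑-adjoint xs K K-sym a b = begin
  ∑ xs (λ j → b j * ∑ xs (λ i → a i * K i j))    ≡⟨ ∑-cong xs (λ j → ∑-*ˡ xs (b j) (λ i → a i * K i j)) ⟨
  ∑ xs (λ j → ∑ xs (λ i → b j * (a i * K i j)))  ≡⟨ ∑-swap xs xs (λ j i → b j * (a i * K i j)) ⟩
  ∑ xs (λ i → ∑ xs (λ j → b j * (a i * K i j)))  ≡⟨ ∑-cong xs (λ i → ∑-cong xs (λ j → swap-factors i j)) ⟩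
  ∑ xs (λ i → ∑ xs (λ j → a i * (b j * K j i)))  ≡⟨ ∑-cong xs (λ i → ∑-*ˡ xs (a i) (λ j → b j * K j i)) ⟩
  ∑ xs (λ i → a i * ∑ xs (λ j → b j * K j i))    ∎
  where
  commute : ∀ x y z → x * (y * z) ≡ y * (x * z)
  commute = solve-∀
  swap-factors : ∀ i j → b j * (a i * K i j) ≡ a i * (b j * K j i)
  swap-factors i j = trans (commute (b j) (a i) (K i j)) (cong (λ k → a i * (b j * k)) (K-sym i j))

[]-∧ : ∀ x y → [ x ∧ y ] ≡ [ x ] * [ y ]
[]-∧ false y     = refl
[]-∧ true  false = refl
[]-∧ true  true  = refl

≡ᵇ-refl : ∀ n → (n ≡ᵇ n) ≡ true
≡ᵇ-refl zero    = refl
≡ᵇ-refl (suc n) = ≡ᵇ-refl n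

≡ᵇ-sym : ∀ m n → (m ≡ᵇ n) ≡ (n ≡ᵇ m)
≡ᵇ-sym zero    zero    = refl
≡ᵇ-sym zero    (suc n) = refl
≡ᵇ-sym (suc m) zero    = refl
≡ᵇ-sym (suc m) (suc n) = ≡ᵇ-sym m n

≢⇒≡ᵇ≡false : ∀ m n → m ≢ n → (m ≡ᵇ n) ≡ false
≢⇒≡ᵇ≡false zero    zero    m≢n = ⊥-elim (m≢n refl)
≢⇒≡ᵇ≡false zero    (suc n) m≢n = refl
≢⇒≡ᵇ≡false (suc m) zero    m≢n = refl
≢⇒≡ᵇ≡false (suc m) (suc n) m≢n = ≢⇒≡ᵇ≡false m n (m≢n ∘ cong suc)

∑-allFin-δ : ∀ n (a : Fin n) (g : Fin n → ℤ) → ∑ (allFin n) (λ a′ → g a′ * [ toℕ a ≡ᵇ toℕ a′ ]) ≡ g a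
∑-allFin-δ (suc n) zero g = begin
  ∑ (allFin (suc n)) (λ a′ → g a′ * [ 0 ≡ᵇ toℕ a′ ])
    ≡⟨ ∑-allFin-suc n (λ a′ → g a′ * [ 0 ≡ᵇ toℕ a′ ]) ⟩
  g zero * 1ℤ + ∑ (allFin n) (λ a′ → g (suc a′) * 0ℤ)
    ≡⟨ cong₂ _+_ (ℤ.*-identityʳ (g zero)) (∑-zero (allFin n) (ℤ.*-zeroʳ ∘ g ∘ suc)) ⟩
  g zero + 0ℤ
    ≡⟨ ℤ.+-identityʳ _ ⟩
  g zero ∎
∑-allFin-δ (suc n) (suc a) g = begin
  ∑ (allFin (suc n)) (λ a′ → g a′ * [ toℕ (suc a) ≡ᵇ toℕ a′ ])
    ≡⟨ ∑-allFin-suc n (λ a′ → g a′ * [ toℕ (suc a) ≡ᵇ toℕ a′ ]) ⟩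
  g zero * 0ℤ + ∑ (allFin n) (λ a′ → g (suc a′) * [ toℕ a ≡ᵇ toℕ a′ ])
    ≡⟨ cong₂ _+_ (ℤ.*-zeroʳ (g zero)) (∑-allFin-δ n a (g ∘ suc)) ⟩
  0ℤ + g (suc a)
    ≡⟨ ℤ.+-identityˡ _ ⟩
  g (suc a) ∎

_==ᵥ_ : ∀ {n k} → Vec (Fin n) k → Vec (Fin n) k → Bool
[]       ==ᵥ []       = true
(x ∷ xs) ==ᵥ (y ∷ ys) = (toℕ x ≡ᵇ toℕ y) ∧ (xs ==ᵥ ys)

==ᵥ-sym : ∀ {n k} (p p′ : Vec (Fin n) k) → (p ==ᵥ p′) ≡ (p′ ==ᵥ p)
==ᵥ-sym []      []        = refl
==ᵥ-sym (x ∷ p) (y ∷ p′) = cong₂ _∧_ (≡ᵇ-sym (toℕ x) (toℕ y)) (==ᵥ-sym p p′)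

∑-allVecs-suc : ∀ n k (g : Vec (Fin n) (suc k) → ℤ) →
                ∑ (allVecs n (suc k)) g ≡ ∑ (allFin n) (λ b → ∑ (allVecs n k) (λ p → g (b ∷ p)))
∑-allVecs-suc n k g =
  trans (∑-concatMap _ (allFin n) g) (∑-cong (allFin n) (λ b → ∑-map (b ∷_) (allVecs n k) g))

∑-allVecs-δ : ∀ n k (p : Vec (Fin n) k) (g : Vec (Fin n) k → ℤ) →
              ∑ (allVecs n k) (λ p′ → g p′ * [ p ==ᵥ p′ ]) ≡ g p
∑-allFin-allVecs-δ : ∀ n m k (a : Fin n) (p : Vec (Fin m) k) (g : Fin n → Vec (Fin m) k → ℤ) →
  ∑ (allFin n) (λ a′ → ∑ (allVecs m k) (λ p′ → g a′ p′ * [ (toℕ a ≡ᵇ toℕ a′) ∧ (p ==ᵥ p′) ])) ≡ g a p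

∑-allVecs-δ n zero    []      g = trans (ℤ.+-identityʳ _) (ℤ.*-identityʳ _)
∑-allVecs-δ n (suc k) (b ∷ p) g =
  trans (∑-allVecs-suc n k (λ p′ → g p′ * [ (b ∷ p) ==ᵥ p′ ]))
        (∑-allFin-allVecs-δ n n k b p (λ b′ p′ → g (b′ ∷ p′)))

∑-allFin-allVecs-δ n m k a p g = begin
  ∑ (allFin n) (λ a′ → ∑ (allVecs m k) (λ p′ → g a′ p′ * [ (toℕ a ≡ᵇ toℕ a′) ∧ (p ==ᵥ p′) ]))
    ≡⟨ ∑-cong (allFin n) factor-head ⟩
  ∑ (allFin n) (λ a′ → ∑ (allVecs m k) (λ p′ → g a′ p′ * [ p ==ᵥ p′ ]) * [ toℕ a ≡ᵇ toℕ a′ ])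
    ≡⟨ ∑-cong (allFin n) (λ a′ → cong (_* [ toℕ a ≡ᵇ toℕ a′ ]) (∑-allVecs-δ m k p (g a′))) ⟩
  ∑ (allFin n) (λ a′ → g a′ p * [ toℕ a ≡ᵇ toℕ a′ ])
    ≡⟨ ∑-allFin-δ n a (λ a′ → g a′ p) ⟩
  g a p ∎
  where
  reassoc : ∀ x y z → x * (y * z) ≡ (x * z) * y
  reassoc = solve-∀
  factor-head : ∀ a′ → ∑ (allVecs m k) (λ p′ → g a′ p′ * [ (toℕ a ≡ᵇ toℕ a′) ∧ (p ==ᵥ p′) ])
                     ≡ ∑ (allVecs m k) (λ p′ → g a′ p′ * [ p ==ᵥ p′ ]) * [ toℕ a ≡ᵇ toℕ a′ ]
  factor-head a′ = trans
    (∑-cong (allVecs m k) (λ p′ → trans (cong (g a′ p′ *_) ([]-∧ (toℕ a ≡ᵇ toℕ a′) (p ==ᵥ p′)))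
                                         (reassoc (g a′ p′) _ _)))
    (∑-*ʳ (allVecs m k) [ toℕ a ≡ᵇ toℕ a′ ] (λ p′ → g a′ p′ * [ p ==ᵥ p′ ]))

m∸n≡1+[m∸1+n] : ∀ {m n} → n < m → m ∸ n ≡ suc (m ∸ suc n)
m∸n≡1+[m∸1+n] {suc m} {zero}  _         = refl
m∸n≡1+[m∸1+n] {suc m} {suc n} (s≤s n<m) = m∸n≡1+[m∸1+n] n<m

geometric : ℕ → ℕ → ℕ
geometric q zero    = 1
geometric q (suc j) = 1 ℕ.+ q ℕ.* geometric q j

module _ (q : ℕ) where

  private
    G : ℕ → ℤ
    G j = + geometric q j

  geometric-suc : ∀ j → geometric q (suc j) ≡ geometric q j ℕ.+ q ^ suc j
  geometric-suc zero    = refl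
  geometric-suc (suc j) = begin
    1 ℕ.+ q ℕ.* geometric q (suc j)                ≡⟨ cong (λ g → 1 ℕ.+ q ℕ.* g) (geometric-suc j) ⟩
    1 ℕ.+ q ℕ.* (geometric q j ℕ.+ q ^ suc j)      ≡⟨ distribute q (geometric q j) (q ^ suc j) ⟩
    (1 ℕ.+ q ℕ.* geometric q j) ℕ.+ q ^ suc (suc j) ∎
    where
    distribute : ∀ q g t → 1 ℕ.+ q ℕ.* (g ℕ.+ t) ≡ (1 ℕ.+ q ℕ.* g) ℕ.+ q ℕ.* t
    distribute = ℕ-solve-∀

  G-suc : ∀ j → G (suc j) ≡ 1ℤ + + q * G j
  G-suc j = trans (ℤ.pos-+ 1 (q ℕ.* geometric q j)) (cong (_+_ 1ℤ) (ℤ.pos-* q (geometric q j)))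

  root-balance : ∀ j → (+ suc q * G (suc j) - + suc q * G j) - 0ℤ ≡ + (q ^ suc j) * (+ suc q * 1ℤ)
  root-balance j = begin
    (+ suc q * G (suc j) - + suc q * G j) - 0ℤ
      ≡⟨ cong (λ g → (+ suc q * g - + suc q * G j) - 0ℤ) (trans (cong +_ (geometric-suc j)) (ℤ.pos-+ _ (q ^ suc j))) ⟩
    (+ suc q * (G j + + (q ^ suc j)) - + suc q * G j) - 0ℤ
      ≡⟨ telescope (+ suc q) (G j) (+ (q ^ suc j)) ⟩
    + (q ^ suc j) * (+ suc q * 1ℤ) ∎
    where
    telescope : ∀ D g t → (D * (g + t) - D * g) - 0ℤ ≡ t * (D * 1ℤ)
    telescope = solve-∀

  interior-balance : ∀ j → (+ suc q * G (suc j) - + q * G j) - G (suc (suc j)) ≡ 0ℤ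
  interior-balance j = begin
    (+ suc q * G (suc j) - + q * G j) - G (suc (suc j))
      ≡⟨ cong₂ (λ g g′ → (+ suc q * g - + q * G j) - g′)
               (G-suc j) (trans (G-suc (suc j)) (cong (λ g → 1ℤ + + q * g) (G-suc j))) ⟩
    (+ suc q * (1ℤ + + q * G j) - + q * G j) - (1ℤ + + q * (1ℤ + + q * G j))
      ≡⟨ cong (λ D → (D * (1ℤ + + q * G j) - + q * G j) - (1ℤ + + q * (1ℤ + + q * G j))) (ℤ.pos-+ 1 q) ⟩
    ((1ℤ + + q) * (1ℤ + + q * G j) - + q * G j) - (1ℤ + + q * (1ℤ + + q * G j))
      ≡⟨ cancel (+ q) (G j) ⟩
    0ℤ ∎
    where
    cancel : ∀ Q g → ((1ℤ + Q) * (1ℤ + Q * g) - Q * g) - (1ℤ + Q * (1ℤ + Q * g)) ≡ 0ℤ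
    cancel = solve-∀

  leaf-balance : (+ suc q * G 0 - 0ℤ) - G 1 ≡ 0ℤ
  leaf-balance = begin
    (+ suc q * 1ℤ - 0ℤ) - G 1                ≡⟨ cong₂ (λ D g → (D * 1ℤ - 0ℤ) - g) (ℤ.pos-+ 1 q) (G-suc 0) ⟩
    ((1ℤ + + q) * 1ℤ - 0ℤ) - (1ℤ + + q * 1ℤ) ≡⟨ cancel (+ q) ⟩
    0ℤ                                       ∎
    where
    cancel : ∀ Q → ((1ℤ + Q) * 1ℤ - 0ℤ) - (1ℤ + Q * 1ℤ) ≡ 0ℤ
    cancel = solve-∀

coprime-1+* : ∀ q n → Coprime q (suc (q ℕ.* n))
coprime-1+* q n {i} (i∣q , i∣1+qn) =
  ∣1⇒≡1 (∣m+n∣m⇒∣n (subst (i ∣_) (+-comm 1 (q ℕ.* n)) i∣1+qn) (∣-trans i∣q (m∣m*n n)))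

coprime-geometric : ∀ q j → Coprime q (geometric q j)
coprime-geometric q zero    = Coprime.sym (1-coprimeTo q)
coprime-geometric q (suc j) = coprime-1+* q (geometric q j)

coprime-divisor-^ : ∀ {m n} .{{_ : NonZero m}} → Coprime m n → ∀ k o → m ^ k ∣ n ℕ.* o → m ^ k ∣ o
coprime-divisor-^         m⊥n zero    o _ = 1∣ o
coprime-divisor-^ {m} {n} m⊥n (suc k) o m^1+k∣n*o
  with coprime-divisor m⊥n (∣-trans (m∣m*n (m ^ k)) m^1+k∣n*o)
... | divides o′ refl = subst (m ℕ.* m ^ k ∣_) (*-comm m o′) (*-monoʳ-∣ m m^k∣o′)
  where
  rearrange : ∀ n o′ m → n ℕ.* (o′ ℕ.* m) ≡ m ℕ.* (n ℕ.* o′)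
  rearrange = ℕ-solve-∀
  m^k∣o′ : m ^ k ∣ o′
  m^k∣o′ = coprime-divisor-^ m⊥n k o′ (*-cancelˡ-∣ m (subst (m ℕ.* m ^ k ∣_) (rearrange n o′ m) m^1+k∣n*o))

module Tree (q h : ℕ) where

  d : ℕ
  d = suc q

  V : Set
  V = Vtx d h

  -- Defs compares the paths of two nodes by a private list equality behind the guard k ≡ᵇ k, so
  -- relating it to _==ᵥ_ has to go through this guarded form.
  private
    ∧-extend : ∀ t A B E E′ → t ≡ true → t ∧ (A ∧ E) ≡ A ∧ E′ → t ∧ (A ∧ (B ∧ E)) ≡ A ∧ (B ∧ E′)
    ∧-extend .true false B E E′ refl _ = refl
    ∧-extend .true true  B E E′ refl e = cong (B ∧_) e

  ==-node : ∀ k (lt lt′ : suc k ≤ h) (a a′ : Fin d) (p p′ : Vec (Fin q) k) →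
            (node k lt a p == node k lt′ a′ p′) ≡ (toℕ a ≡ᵇ toℕ a′) ∧ (p ==ᵥ p′)
  ==-node zero    lt lt′ a a′ []      []        = refl
  ==-node (suc k) lt lt′ a a′ (b ∷ p) (b′ ∷ p′) =
    ∧-extend (k ≡ᵇ k) (toℕ a ≡ᵇ toℕ a′) (toℕ b ≡ᵇ toℕ b′) _ _ (≡ᵇ-refl k)
      (==-node k (<⇒≤ lt) (<⇒≤ lt′) a a′ p p′)

  ==-sym : ∀ (v w : V) → (v == w) ≡ (w == v)
  ==-sym root            root              = refl
  ==-sym root            (node _ _ _ _)    = refl
  ==-sym (node _ _ _ _)  root              = refl
  ==-sym (node k lt a p) (node k′ lt′ a′ p′) with k ≟ k′
  ... | yes refl = begin
    node k lt a p == node k lt′ a′ p′  ≡⟨ ==-node k lt lt′ a a′ p p′ ⟩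
    (toℕ a ≡ᵇ toℕ a′) ∧ (p ==ᵥ p′)     ≡⟨ cong₂ _∧_ (≡ᵇ-sym (toℕ a) (toℕ a′)) (==ᵥ-sym p p′) ⟩
    (toℕ a′ ≡ᵇ toℕ a) ∧ (p′ ==ᵥ p)     ≡⟨ ==-node k lt′ lt a′ a p′ p ⟨
    node k lt′ a′ p′ == node k lt a p  ∎
  ... | no k≢k′ rewrite ≢⇒≡ᵇ≡false k k′ k≢k′ | ≢⇒≡ᵇ≡false k′ k (k≢k′ ∘ sym) = refl

  levelSum : (m : ℕ) → suc m ≤ h → (V → ℤ) → ℤ
  levelSum m lt F = ∑ (allFin d) (λ a → ∑ (allVecs q m) (λ p → F (node m lt a p)))

  ∑-nodesUpTo-suc : ∀ m (lt : suc m ≤ h) F →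
    ∑ (nodesUpTo d h (suc m) lt) F ≡ ∑ (nodesUpTo d h m (≤-trans (n≤1+n m) lt)) F + levelSum m lt F
  ∑-nodesUpTo-suc m lt F = begin
    ∑ (nodesUpTo d h m _ ++ level d h m lt) F                 ≡⟨ ∑-++ (nodesUpTo d h m _) (level d h m lt) F ⟩
    ∑ (nodesUpTo d h m _) F + ∑ (level d h m lt) F            ≡⟨ cong (_+_ (∑ (nodesUpTo d h m _) F)) ∑-level ⟩
    ∑ (nodesUpTo d h m _) F + levelSum m lt F                ∎
    where
    ∑-level : ∑ (level d h m lt) F ≡ levelSum m lt F
    ∑-level = trans (∑-concatMap (λ a → map (node m lt a) (allVecs q m)) (allFin d) F)
                    (∑-cong (allFin d) (λ a → ∑-map (node m lt a) (allVecs q m) F))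

  VanishesOffLevel : ℕ → (V → ℤ) → Set
  VanishesOffLevel j F = ∀ k lt a p → k ≢ j → F (node k lt a p) ≡ 0ℤ

  levelSum-vanishing : ∀ j F → VanishesOffLevel j F → ∀ m lt → m ≢ j → levelSum m lt F ≡ 0ℤ
  levelSum-vanishing j F F≡0 m lt m≢j =
    ∑-zero (allFin d) (λ a → ∑-zero (allVecs q m) (λ p → F≡0 m lt a p m≢j))

  ∑-nodesUpTo-below : ∀ j F → VanishesOffLevel j F → ∀ m le → m ≤ j → ∑ (nodesUpTo d h m le) F ≡ 0ℤ
  ∑-nodesUpTo-below j F F≡0 zero    le _   = refl
  ∑-nodesUpTo-below j F F≡0 (suc m) lt m<j = trans (∑-nodesUpTo-suc m lt F)
    (cong₂ _+_ (∑-nodesUpTo-below j F F≡0 m _ (<⇒≤ m<j)) (levelSum-vanishing j F F≡0 m lt (<⇒≢ m<j)))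

  ∑-nodesUpTo-above : ∀ j F → VanishesOffLevel j F → (ltj : suc j ≤ h) →
                      ∀ m le → j < m → ∑ (nodesUpTo d h m le) F ≡ levelSum j ltj F
  ∑-nodesUpTo-above j F F≡0 ltj (suc m) lt (s≤s j≤m) with j ≟ m
  ... | yes refl = trans (∑-nodesUpTo-suc m lt F)
        (trans (cong₂ _+_ (∑-nodesUpTo-below j F F≡0 m _ ≤-refl) (cong (λ l → levelSum m l F) (≤-irrelevant lt ltj)))
               (ℤ.+-identityˡ _))
  ... | no j≢m = trans (∑-nodesUpTo-suc m lt F)
        (trans (cong₂ _+_ (∑-nodesUpTo-above j F F≡0 ltj m _ (≤∧≢⇒< j≤m j≢m))
                          (levelSum-vanishing j F F≡0 m lt (j≢m ∘ sym)))
               (ℤ.+-identityʳ _))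

  ∑V : (V → ℤ) → ℤ
  ∑V = ∑ (allV d h)

  ∑V-δ : ∀ (g : V → ℤ) v → ∑V (λ j → g j * [ v == j ]) ≡ g v
  ∑V-δ g root = begin
    g root * 1ℤ + ∑ (nodesUpTo d h h ≤-refl) (λ j → g j * [ root == j ])
      ≡⟨ cong₂ _+_ (ℤ.*-identityʳ (g root))
                   (∑-nodesUpTo-below h (λ j → g j * [ root == j ]) (λ k lt a p _ → ℤ.*-zeroʳ (g (node k lt a p)))
                                      h ≤-refl ≤-refl) ⟩
    g root + 0ℤ
      ≡⟨ ℤ.+-identityʳ _ ⟩
    g root ∎
  ∑V-δ g (node k lt a p) = begin
    g root * 0ℤ + ∑ (nodesUpTo d h h ≤-refl) F
      ≡⟨ cong₂ _+_ (ℤ.*-zeroʳ (g root)) (∑-nodesUpTo-above k F F≡0 lt h ≤-refl lt) ⟩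
    0ℤ + levelSum k lt F
      ≡⟨ ℤ.+-identityˡ _ ⟩
    ∑ (allFin d) (λ a′ → ∑ (allVecs q k) (λ p′ → g (node k lt a′ p′) * [ node k lt a p == node k lt a′ p′ ]))
      ≡⟨ ∑-cong (allFin d) (λ a′ → ∑-cong (allVecs q k) (λ p′ →
           cong (λ b → g (node k lt a′ p′) * [ b ]) (==-node k lt lt a a′ p p′))) ⟩
    ∑ (allFin d) (λ a′ → ∑ (allVecs q k) (λ p′ → g (node k lt a′ p′) * [ (toℕ a ≡ᵇ toℕ a′) ∧ (p ==ᵥ p′) ]))
      ≡⟨ ∑-allFin-allVecs-δ d q k a p (λ a′ p′ → g (node k lt a′ p′)) ⟩
    g (node k lt a p) ∎
    where
    F : V → ℤ
    F j = g j * [ node k lt a p == j ]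
    F≡0 : VanishesOffLevel k F
    F≡0 k′ lt′ a′ p′ k′≢k rewrite ≢⇒≡ᵇ≡false k k′ (k′≢k ∘ sym) =
      ℤ.*-zeroʳ (g (node k′ lt′ a′ p′))

  δ-expand : ∀ i v → δ d h i v ≡ (+ d * [ v == i ] - [ isChild i v ]) - [ isChild v i ]
  δ-expand i v = cong₂ _-_
    (cong (λ b → + d * [ v == i ] - [ not (isRoot i) ∧ b ]) (==-sym v (parent i)))
    (∑V-δ (λ j → [ isChild j i ]) v)

  δ-sym : ∀ i v → δ d h i v ≡ δ d h v i
  δ-sym i v = begin
    δ d h i v
      ≡⟨ δ-expand i v ⟩
    (+ d * [ v == i ] - [ isChild i v ]) - [ isChild v i ]
      ≡⟨ cong (λ b → (+ d * [ b ] - [ isChild i v ]) - [ isChild v i ]) (==-sym v i) ⟩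
    (+ d * [ i == v ] - [ isChild i v ]) - [ isChild v i ]
      ≡⟨ swap-subtrahends (+ d * [ i == v ]) [ isChild i v ] [ isChild v i ] ⟩
    (+ d * [ i == v ] - [ isChild v i ]) - [ isChild i v ]
      ≡⟨ δ-expand v i ⟨
    δ d h v i ∎
    where
    swap-subtrahends : ∀ a x y → (a - x) - y ≡ (a - y) - x
    swap-subtrahends = solve-∀

  laplacian : (V → ℤ) → V → ℤ
  laplacian a v = ∑V (λ i → a i * δ d h i v)

  childSum parentSum : (V → ℤ) → V → ℤ
  childSum  a v = ∑V (λ i → a i * [ isChild i v ])
  parentSum a v = ∑V (λ i → a i * [ isChild v i ])

  laplacian-expand : ∀ a v → laplacian a v ≡ (+ d * a v - childSum a v) - parentSum a v
  laplacian-expand a v = begin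
    ∑V (λ i → a i * δ d h i v)
      ≡⟨ ∑-cong (allV d h) (λ i → trans (cong (a i *_) (δ-expand i v)) (distribute (+ d) (a i) _ _ _)) ⟩
    ∑V (λ i → + d * (a i * [ v == i ]) + (- (a i * [ isChild i v ]) + - (a i * [ isChild v i ])))
      ≡⟨ ∑-+ (allV d h) (λ i → + d * (a i * [ v == i ])) _ ⟩
    ∑V (λ i → + d * (a i * [ v == i ])) + ∑V (λ i → - (a i * [ isChild i v ]) + - (a i * [ isChild v i ]))
      ≡⟨ cong₂ _+_ (trans (∑-*ˡ (allV d h) (+ d) (λ i → a i * [ v == i ])) (cong (+ d *_) (∑V-δ a v)))
                   (trans (∑-+ (allV d h) (λ i → - (a i * [ isChild i v ])) _)
                          (cong₂ _+_ (∑-neg (allV d h) (λ i → a i * [ isChild i v ]))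
                                     (∑-neg (allV d h) (λ i → a i * [ isChild v i ])))) ⟩
    + d * a v + (- childSum a v + - parentSum a v)
      ≡⟨ regroup (+ d * a v) (childSum a v) (parentSum a v) ⟩
    (+ d * a v - childSum a v) - parentSum a v ∎
    where
    distribute : ∀ D A X Y Z → A * ((D * X - Y) - Z) ≡ D * (A * X) + (- (A * Y) + - (A * Z))
    distribute = solve-∀
    regroup : ∀ A B C → A + (- B + - C) ≡ (A - B) - C
    regroup = solve-∀

  parentSum-root : ∀ a → parentSum a root ≡ 0ℤ
  parentSum-root a = ∑-zero (allV d h) (λ i → ℤ.*-zeroʳ (a i))

  parentSum-node : ∀ a k lt b p → parentSum a (node k lt b p) ≡ a (parent (node k lt b p))
  parentSum-node a k lt b p = ∑V-δ a (parent (node k lt b p))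

  potential : V → ℤ
  potential root           = + geometric q h
  potential (node k _ _ _) = + geometric q (h ∸ suc k)

  potential-parent : ∀ k lt b p → potential (parent (node k lt b p)) ≡ + geometric q (h ∸ k)
  potential-parent zero    lt b []      = refl
  potential-parent (suc k) lt b (_ ∷ p) = refl

  potential-children : V → V → ℤ
  potential-children v i = potential i * [ isChild i v ]

  potential-children-root-level : VanishesOffLevel 0 (potential-children root)
  potential-children-root-level zero    lt a []      0≢0 = ⊥-elim (0≢0 refl)
  potential-children-root-level (suc k) lt a (_ ∷ p) _   = ℤ.*-zeroʳ (+ geometric q (h ∸ suc (suc k)))

  potential-children-node-level : ∀ k lt b p → VanishesOffLevel (suc k) (potential-children (node k lt b p))
  potential-children-node-level k lt b p zero     lt′ a []      _      = ℤ.*-zeroʳ (+ geometric q (h ∸ 1))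
  potential-children-node-level k lt b p (suc k′) lt′ a (_ ∷ p′) k′≢k
    rewrite ≢⇒≡ᵇ≡false k′ k (k′≢k ∘ cong suc) = ℤ.*-zeroʳ (+ geometric q (h ∸ suc (suc k′)))

  childSum-potential-root : (0<h : 1 ≤ h) → childSum potential root ≡ + d * + geometric q (h ∸ 1)
  childSum-potential-root 0<h = begin
    potential root * 0ℤ + ∑ (nodesUpTo d h h ≤-refl) (potential-children root)
      ≡⟨ cong₂ _+_ (ℤ.*-zeroʳ (potential root))
                   (∑-nodesUpTo-above 0 (potential-children root) potential-children-root-level 0<h h ≤-refl 0<h) ⟩
    0ℤ + ∑ (allFin d) (λ _ → + geometric q (h ∸ 1) * 1ℤ + 0ℤ)
      ≡⟨ trans (ℤ.+-identityˡ _)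
               (∑-cong (allFin d) (λ _ → trans (ℤ.+-identityʳ _) (ℤ.*-identityʳ (+ geometric q (h ∸ 1))))) ⟩
    ∑ (allFin d) (λ _ → + geometric q (h ∸ 1))
      ≡⟨ ∑-allFin-const d _ ⟩
    + d * + geometric q (h ∸ 1) ∎

  childSum-potential-inner : ∀ k lt b p → suc (suc k) ≤ h →
                             childSum potential (node k lt b p) ≡ + q * + geometric q (h ∸ suc (suc k))
  childSum-potential-inner k lt b p lt₂ = begin
    potential root * 0ℤ + ∑ (nodesUpTo d h h ≤-refl) F
      ≡⟨ cong₂ _+_ (ℤ.*-zeroʳ (potential root))
                   (∑-nodesUpTo-above (suc k) F (potential-children-node-level k lt b p) lt₂ h ≤-refl lt₂) ⟩
    0ℤ + levelSum (suc k) lt₂ F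
      ≡⟨ ℤ.+-identityˡ _ ⟩
    ∑ (allFin d) (λ a′ → ∑ (allVecs q (suc k)) (λ p′ → F (node (suc k) lt₂ a′ p′)))
      ≡⟨ ∑-cong (allFin d) (λ a′ → ∑-allVecs-suc q k (λ p′ → F (node (suc k) lt₂ a′ p′))) ⟩
    ∑ (allFin d) (λ a′ → ∑ (allFin q) (λ b′ → ∑ (allVecs q k) (λ p′ → F (node (suc k) lt₂ a′ (b′ ∷ p′)))))
      ≡⟨ ∑-swap (allFin d) (allFin q) (λ a′ b′ → ∑ (allVecs q k) (λ p′ → F (node (suc k) lt₂ a′ (b′ ∷ p′))))
       ⟩
    ∑ (allFin q) (λ b′ → ∑ (allFin d) (λ a′ → ∑ (allVecs q k) (λ p′ → F (node (suc k) lt₂ a′ (b′ ∷ p′)))))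
      ≡⟨ ∑-cong (allFin q) (λ b′ →
           trans (∑-cong (allFin d) (λ a′ → ∑-cong (allVecs q k) (λ p′ → child-test a′ b′ p′)))
                 (∑-allFin-allVecs-δ d q k b p (λ _ _ → K))) ⟩
    ∑ (allFin q) (λ _ → K)
      ≡⟨ ∑-allFin-const q K ⟩
    + q * K ∎
    where
    K : ℤ
    K = + geometric q (h ∸ suc (suc k))
    F : V → ℤ
    F = potential-children (node k lt b p)
    child-test : ∀ a′ b′ p′ →
                 F (node (suc k) lt₂ a′ (b′ ∷ p′)) ≡ K * [ (toℕ b ≡ᵇ toℕ a′) ∧ (p ==ᵥ p′) ]
    child-test a′ b′ p′ = cong (λ t → K * [ t ])
      (trans (==-sym (node k (<⇒≤ lt₂) a′ p′) (node k lt b p)) (==-node k lt (<⇒≤ lt₂) b a′ p p′))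

  childSum-potential-leaf : ∀ k lt b p → ¬ (suc (suc k) ≤ h) → childSum potential (node k lt b p) ≡ 0ℤ
  childSum-potential-leaf k lt b p ¬lt₂ = cong₂ _+_ (ℤ.*-zeroʳ (potential root))
    (∑-nodesUpTo-below (suc k) (potential-children (node k lt b p)) (potential-children-node-level k lt b p)
                       h ≤-refl (≤-pred (≰⇒> ¬lt₂)))

  laplacian-potential-root : 1 ≤ h → laplacian potential root ≡ + (q ^ h) * (+ d * 1ℤ)
  laplacian-potential-root 0<h = begin
    laplacian potential root
      ≡⟨ laplacian-expand potential root ⟩
    (+ d * + geometric q h - childSum potential root) - parentSum potential root
      ≡⟨ cong₂ (λ c p → (+ d * + geometric q h - c) - p) (childSum-potential-root 0<h) (parentSum-root potential) ⟩
    (+ d * + geometric q h - + d * + geometric q (h ∸ 1)) - 0ℤ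
      ≡⟨ subst (λ n → (+ d * + geometric q n - + d * + geometric q (n ∸ 1)) - 0ℤ ≡ + (q ^ n) * (+ d * 1ℤ))
               (sym (m∸n≡1+[m∸1+n] 0<h)) (root-balance q (h ∸ 1)) ⟩
    + (q ^ h) * (+ d * 1ℤ) ∎

  laplacian-potential-node-expand : ∀ k lt b p → laplacian potential (node k lt b p)
    ≡ (+ d * + geometric q (h ∸ suc k) - childSum potential (node k lt b p)) - + geometric q (h ∸ k)
  laplacian-potential-node-expand k lt b p =
    trans (laplacian-expand potential (node k lt b p))
          (cong (_-_ (+ d * + geometric q (h ∸ suc k) - childSum potential (node k lt b p)))
                (trans (parentSum-node potential k lt b p) (potential-parent k lt b p)))

  laplacian-potential-inner : ∀ k lt b p → suc (suc k) ≤ h → laplacian potential (node k lt b p) ≡ 0ℤ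
  laplacian-potential-inner k lt b p lt₂ = begin
    laplacian potential (node k lt b p)
      ≡⟨ laplacian-potential-node-expand k lt b p ⟩
    (+ d * + geometric q (h ∸ suc k) - childSum potential (node k lt b p)) - + geometric q (h ∸ k)
      ≡⟨ cong₂ (λ c n → (+ d * + geometric q (h ∸ suc k) - c) - + geometric q n)
               (childSum-potential-inner k lt b p lt₂) (m∸n≡1+[m∸1+n] lt) ⟩
    (+ d * + geometric q (h ∸ suc k) - + q * + geometric q j) - + geometric q (suc (h ∸ suc k))
      ≡⟨ cong (λ n → (+ d * + geometric q n - + q * + geometric q j) - + geometric q (suc n)) (m∸n≡1+[m∸1+n] lt₂) ⟩
    (+ d * + geometric q (suc j) - + q * + geometric q j) - + geometric q (suc (suc j))
      ≡⟨ interior-balance q j ⟩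
    0ℤ ∎
    where
    j : ℕ
    j = h ∸ suc (suc k)

  laplacian-potential-leaf : ∀ k lt b p → ¬ (suc (suc k) ≤ h) → laplacian potential (node k lt b p) ≡ 0ℤ
  laplacian-potential-leaf k lt b p ¬lt₂ = begin
    laplacian potential (node k lt b p)
      ≡⟨ laplacian-potential-node-expand k lt b p ⟩
    (+ d * + geometric q (h ∸ suc k) - childSum potential (node k lt b p)) - + geometric q (h ∸ k)
      ≡⟨ cong₂ (λ c n → (+ d * + geometric q (h ∸ suc k) - c) - + geometric q n)
               (childSum-potential-leaf k lt b p ¬lt₂) (m∸n≡1+[m∸1+n] lt) ⟩
    (+ d * + geometric q (h ∸ suc k) - 0ℤ) - + geometric q (suc (h ∸ suc k))
      ≡⟨ cong (λ n → (+ d * + geometric q n - 0ℤ) - + geometric q (suc n)) (m≤n⇒m∸n≡0 (≤-pred (≰⇒> ¬lt₂))) ⟩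
    (+ d * + geometric q 0 - 0ℤ) - + geometric q 1
      ≡⟨ leaf-balance q ⟩
    0ℤ ∎

  laplacian-potential-node : ∀ k lt b p → laplacian potential (node k lt b p) ≡ 0ℤ
  laplacian-potential-node k lt b p with suc (suc k) ≤? h
  ... | yes lt₂ = laplacian-potential-inner k lt b p lt₂
  ... | no ¬lt₂ = laplacian-potential-leaf k lt b p ¬lt₂

  generator : V → ℤ
  generator v = + d * [ v == root ]

  laplacian-potential : 1 ≤ h → ∀ v → laplacian potential v ≡ + (q ^ h) * generator v
  laplacian-potential 0<h root              = laplacian-potential-root 0<h
  laplacian-potential 0<h (node k lt b p)   =
    trans (laplacian-potential-node k lt b p) (sym (trans (cong (+ (q ^ h) *_) (ℤ.*-zeroʳ (+ d))) (ℤ.*-zeroʳ (+ (q ^ h)))))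

  ∑V-generator : ∀ (f : V → ℤ) k → ∑V (λ v → f v * (k * generator v)) ≡ f root * (k * + d)
  ∑V-generator f k = trans
    (∑-cong (allV d h) (λ v → trans (cong (λ t → f v * (k * (+ d * [ t ]))) (==-sym v root))
                                    (reassoc (f v) k (+ d) [ root == v ])))
    (∑V-δ (λ v → f v * (k * + d)) root)
    where
    reassoc : ∀ x k d t → x * (k * (d * t)) ≡ (x * (k * d)) * t
    reassoc = solve-∀

  q^h∣geometric*m : 1 ≤ h → ∀ m → InLattice d h (m • generator) → q ^ h ∣ geometric q h ℕ.* m
  q^h∣geometric*m 0<h m (a , m•generator≡) = divides ∣ a root ∣ (begin
    geometric q h ℕ.* m       ≡⟨ ℤ.abs-* (+ geometric q h) (+ m) ⟨
    ∣ potential root * + m ∣  ≡⟨ cong ∣_∣ cancelled ⟩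
    ∣ a root * + (q ^ h) ∣    ≡⟨ ℤ.abs-* (a root) (+ (q ^ h)) ⟩
    ∣ a root ∣ ℕ.* q ^ h      ∎)
    where
    pairing : potential root * (+ m * + d) ≡ a root * (+ (q ^ h) * + d)
    pairing = begin
      potential root * (+ m * + d)
        ≡⟨ ∑V-generator potential (+ m) ⟨
      ∑V (λ v → potential v * (+ m * generator v))
        ≡⟨ ∑-cong (allV d h) (λ v → cong (potential v *_) (m•generator≡ v)) ⟩
      ∑V (λ v → potential v * laplacian a v)
        ≡⟨ ∑-adjoint (allV d h) (δ d h) δ-sym a potential ⟩
      ∑V (λ i → a i * laplacian potential i)
        ≡⟨ ∑-cong (allV d h) (λ i → cong (a i *_) (laplacian-potential 0<h i)) ⟩
      ∑V (λ i → a i * (+ (q ^ h) * generator i))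
        ≡⟨ ∑V-generator a (+ (q ^ h)) ⟩
      a root * (+ (q ^ h) * + d) ∎
    cancelled : potential root * + m ≡ a root * + (q ^ h)
    cancelled = ℤ.*-cancelʳ-≡ (potential root * + m) (a root * + (q ^ h)) (+ d) (begin
      potential root * + m * + d    ≡⟨ ℤ.*-assoc (potential root) (+ m) (+ d) ⟩
      potential root * (+ m * + d)  ≡⟨ pairing ⟩
      a root * (+ (q ^ h) * + d)    ≡⟨ ℤ.*-assoc (a root) (+ (q ^ h)) (+ d) ⟨
      a root * + (q ^ h) * + d      ∎)

lemma8p18 : (d h : ℕ) → 3 ≤ d → 1 ≤ h → HasCyclicSubgroupOfOrder d h ((d ∸ 1) ^ h)
lemma8p18 (suc (suc (suc r))) h (s≤s (s≤s (s≤s z≤n))) 0<h =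
  generator , m^n>0 q h , (potential , λ v → sym (laplacian-potential 0<h v)) , minimal
  where
  q : ℕ
  q = suc (suc r)
  open Tree q h
  minimal : ∀ m → 0 < m → m < q ^ h → ¬ InLattice d h (m • generator)
  minimal m 0<m m<q^h m•generator∈L = <⇒≱ m<q^h (∣⇒≤ {{>-nonZero 0<m}}
    (coprime-divisor-^ (coprime-geometric q h) h m (q^h∣geometric*m 0<h m m•generator∈L)))
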